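{- Let $P$ be a prime and $C\subset\mathbb{Z}/P\mathbb{Z}$ non-empty. Suppose there exist $S'\subset\mathbb{Z}/P\mathbb{Z}$ with $S'=-S'$ and $0\in S'$, a real $0<\beta\le1$ and constants $c(l)>0$ depending only on $l$, such that for every integer $l\ge2$ and all $h_1,\dots,h_l\in\mathbb{Z}/P\mathbb{Z}$ with $h_i-h_j\notin S'$ for $i\ne j$, $d\big((C+h_1)\cap\dots\cap(C+h_l)\big)\le\frac{c(l)}{\beta^l}d(C)^l$. Let $B\subset\mathbb{Z}/P\mathbb{Z}$, $l\ge1$, and $\tilde y=(y_1,\dots,y_l)\in B^l$ with $C(G(\tilde y))=r$. Then $$\operatorname{card}\big((C-y_1)\cap\dots\cap(C-y_l)\big)\le\frac{c(r)P\,d(C)^r}{\beta^r},$$ where $c(r)>0$ is a constant depending only on $r$.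
   Context: $d(C)=\operatorname{card}(C)/P$. For $\tilde y=(y_1,\dots,y_l)\in B^l$, $G(\tilde y)$ is the graph with vertex set $\{y_1,\dots,y_l\}$ in which $y_i$ and $y_j$ are joined by an edge iff $y_i-y_j\in S'$; $C(G(\tilde y))$ denotes its number of connected components.
   Formalization: The parameter β and the constants c(l) are rational rather than real. -}

module Defs where

open import Data.Nat as ℕ using (ℕ; zero; suc; NonZero)
open import Data.Nat.DivMod using (_mod_)
open import Data.Nat.Primality using (Prime; prime⇒nonZero)
open import Data.Fin using (Fin; toℕ)
open import Data.Fin.Subset using (Subset; ∣_∣; _∈_; _∩_; ⊤)
open import Data.Vec using (tabulate; lookup)
open import Data.Integer using (+_)
open import Data.Rational as ℚ using (ℚ; 0ℚ; 1ℚ; _*_; _/_; 1/_; _>_)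
open import Data.Product using (Σ; ∃; _×_)
open import Data.Sum using (_⊎_)
open import Relation.Binary.PropositionalEquality using (_≡_)
open import Relation.Binary.Construct.Closure.ReflexiveTransitive using (Star)

_^ℚ_ : ℚ → ℕ → ℚ
x ^ℚ zero  = 1ℚ
x ^ℚ suc n = x * (x ^ℚ n)

inv : (β : ℚ) → β > 0ℚ → ℚ
inv β β>0 = 1/_ β {{ℚ.>-nonZero β>0}}

-- ℤ/Pℤ for a prime P, represented by residues Fin P = {0,…,P-1};
-- subsets of ℤ/Pℤ are Subset P (characteristic vectors).
module ZMod (P : ℕ) (pr : Prime P) where
  instance
    P≢0 : NonZero P
    P≢0 = prime⇒nonZero pr

  ZP : Set
  ZP = Fin P

  0ₘ : ZP
  0ₘ = 0 mod P

  _+ₘ_ : ZP → ZP → ZP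
  x +ₘ y = (toℕ x ℕ.+ toℕ y) mod P

  -ₘ_ : ZP → ZP
  -ₘ x = (P ℕ.∸ toℕ x) mod P

  _-ₘ_ : ZP → ZP → ZP
  x -ₘ y = x +ₘ (-ₘ y)

  -- translate A + h = { a + h : a ∈ A } = { z : z - h ∈ A }
  _+ₛ_ : Subset P → ZP → Subset P
  A +ₛ h = tabulate (λ z → lookup A (z -ₘ h))

  _-ₛ_ : Subset P → ZP → Subset P
  A -ₛ y = A +ₛ (-ₘ y)

  ⋂ᶠ : {l : ℕ} → (Fin l → Subset P) → Subset P
  ⋂ᶠ {zero}  A = ⊤
  ⋂ᶠ {suc l} A = A Fin.zero ∩ ⋂ᶠ (λ i → A (Fin.suc i))
    where import Data.Fin as Fin

  card : Subset P → ℕ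
  card A = ∣ A ∣

  d : Subset P → ℚ
  d A = (+ ∣ A ∣) / P

  Symmetric : Subset P → Set
  Symmetric S' = (x : ZP) → (x ∈ S' → (-ₘ x) ∈ S') × ((-ₘ x) ∈ S' → x ∈ S')

  -- The graph G(ỹ): vertices y₁,…,yₗ (as a set), edge yᵢ — yⱼ iff yᵢ - yⱼ ∈ S'.
  -- Two indices represent the same or adjacent vertices:
  Adj : (S' : Subset P) {l : ℕ} → (Fin l → ZP) → Fin l → Fin l → Set
  Adj S' y i j = (y i ≡ y j) ⊎ ((y i -ₘ y j) ∈ S')

  Connected : (S' : Subset P) {l : ℕ} → (Fin l → ZP) → Fin l → Fin l → Set
  Connected S' y = Star (Adj S' y)

  -- C(G(ỹ)) = r : the connected components are indexed by Fin r, i.e.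
  -- there is a surjection comp : Fin l → Fin r with
  -- comp i ≡ comp j  iff  yᵢ, yⱼ are in the same component.
  NumComponents : (S' : Subset P) {l : ℕ} → (Fin l → ZP) → ℕ → Set
  NumComponents S' {l} y r =
    Σ (Fin l → Fin r) λ comp →
      ((k : Fin r) → ∃ λ i → comp i ≡ k) ×
      ((i j : Fin l) → (comp i ≡ comp j → Connected S' y i j) × (Connected S' y i j → comp i ≡ comp j))

-- Constant used in the conclusion: c(r) for r ≥ 2, and 1 for r = 1
-- (for r = 1 the hypothesis gives no information on c(1)).
cExt : (ℕ → ℚ) → ℕ → ℚ
cExt c (suc zero) = 1ℚ
cExt c r          = c r

module Submission where

-- Let X = (C - y₁) ∩ … ∩ (C - yₗ).  The components of G(ỹ)
-- are indexed by Fin r; pick one index rep k in every component k and put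
-- hₖ = -y_{rep k}.  Two representatives of different components are not
-- adjacent, so hₐ - h_b = y_{rep b} - y_{rep a} ∉ S' for a ≠ b, and X is
-- contained in Y = (C + h₁) ∩ … ∩ (C + h_r), since Y intersects a subfamily.
--   * r ≥ 2: the hypothesis bounds d(Y), hence card X ≤ P·d(Y) ≤ c(r) P d(C)^r β^-r.
--   * r = 1: card X ≤ card (C - y₁) = card C = P·d(C) ≤ P·d(C)·β⁻¹, as β ≤ 1.
--   * r = 0 is impossible, since l ≥ 1 and every index lies in a component.

open import Defs
open import Data.Nat as ℕ using (ℕ; _≥_)
open import Data.Nat.Primality using (Prime)
open import Data.Fin using (Fin)
open import Data.Fin.Subset using (Subset; _∈_; _∉_)
open import Data.Integer using (+_)
open import Data.Rational as ℚ using (ℚ; 0ℚ; 1ℚ; _*_; _/_; _≤_; _<_)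
open import Data.Product using (∃; _×_)
open import Relation.Binary.PropositionalEquality using (_≢_)

open import Data.Nat using (zero; suc; s≤s; z≤n; _%_; _∸_)
import Data.Nat.Properties as ℕP
open import Data.Nat.DivMod using (_mod_; %-distribˡ-+; m<n⇒m%n≡m; n%n≡0; [m+n]%n≡m%n)
import Data.Fin as F
open import Data.Fin using (toℕ)
import Data.Fin.Properties as FP
open import Data.Fin.Subset using (∣_∣; Side; inside; outside; _⊆_)
open import Data.Fin.Subset.Properties using (x∈p∩q⁺; p∩q⊆p; p∩q⊆q; ∈⊤; p⊆q⇒∣p∣≤∣q∣)
open import Data.Vec using ([]; _∷_; tabulate; lookup)
open import Data.Vec.Properties using (lookup∘tabulate)
open import Data.Fin.Permutation using (Permutation′; permutation; _⟨$⟩ʳ_)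
import Algebra.Properties.CommutativeMonoid.Sum as MonoidSum
open import Relation.Binary.PropositionalEquality
open import Data.Product using (_,_; proj₁; proj₂)
open import Data.Sum using (inj₂)
open import Relation.Binary.Construct.Closure.ReflexiveTransitive using (ε; _◅_)
import Data.Integer as ℤ
import Data.Integer.Properties as ℤP
import Data.Rational.Properties as ℚP
import Data.Rational.Unnormalised as U
import Data.Rational.Unnormalised.Properties as UP
open import Algebra.Solver.CommutativeMonoid ℚP.*-1-commutativeMonoid using (solve; _⊕_; _⊜_; id)

open MonoidSum ℕP.+-0-commutativeMonoid using (sum; sum-cong-≋; sum-permute)

indicator : Side → ℕ
indicator inside  = 1
indicator outside = 0

card-as-sum : ∀ {n} (A : Subset n) → ∣ A ∣ ≡ sum (λ i → indicator (lookup A i))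
card-as-sum []            = refl
card-as-sum (inside ∷ A)  = cong suc (card-as-sum A)
card-as-sum (outside ∷ A) = card-as-sum A

card-preimage : ∀ {n} (A : Subset n) (π : Permutation′ n) →
  ∣ tabulate (λ z → lookup A (π ⟨$⟩ʳ z)) ∣ ≡ ∣ A ∣
card-preimage {n} A π = begin
  ∣ tabulate (λ z → lookup A (π ⟨$⟩ʳ z)) ∣
    ≡⟨ card-as-sum (tabulate (λ z → lookup A (π ⟨$⟩ʳ z))) ⟩
  sum (λ i → indicator (lookup (tabulate (λ z → lookup A (π ⟨$⟩ʳ z))) i))
    ≡⟨ sum-cong-≋ {n} (λ i → cong indicator (lookup∘tabulate _ i)) ⟩
  sum (λ i → indicator (lookup A (π ⟨$⟩ʳ i)))
    ≡⟨ sym (sum-permute (λ i → indicator (lookup A i)) π) ⟩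
  sum (λ i → indicator (lookup A i))
    ≡⟨ sym (card-as-sum A) ⟩
  ∣ A ∣ ∎
  where open ≡-Reasoning

toℚᵘ-/ : ∀ n d → ℚ.toℚᵘ ((+ n) / suc d) U.≃ U.mkℚᵘ (+ n) d
toℚᵘ-/ n d = ℚP.toℚᵘ-fromℚᵘ (U.mkℚᵘ (+ n) d)

n≡P*n/P : ∀ P .{{_ : ℕ.NonZero P}} n → (+ n) / 1 ≡ ((+ P) / 1) * ((+ n) / P)
n≡P*n/P (suc p) n = ℚP.toℚᵘ-injective (UP.≃-sym unnormalised)
  where
  cross : (+ suc p ℤ.* + n) ℤ.* + 1 ≡ + n ℤ.* + suc (p ℕ.+ 0)
  cross = begin
    (+ suc p ℤ.* + n) ℤ.* + 1   ≡⟨ ℤP.*-identityʳ _ ⟩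
    + suc p ℤ.* + n             ≡⟨ ℤP.*-comm (+ suc p) (+ n) ⟩
    + n ℤ.* + suc p             ≡⟨ cong (λ t → + n ℤ.* + suc t) (sym (ℕP.+-identityʳ p)) ⟩
    + n ℤ.* + suc (p ℕ.+ 0) ∎
    where open ≡-Reasoning

  unnormalised : ℚ.toℚᵘ (((+ suc p) / 1) * ((+ n) / suc p)) U.≃ ℚ.toℚᵘ ((+ n) / 1)
  unnormalised = begin
    ℚ.toℚᵘ (((+ suc p) / 1) * ((+ n) / suc p))
      ≈⟨ ℚP.toℚᵘ-homo-* ((+ suc p) / 1) ((+ n) / suc p) ⟩
    ℚ.toℚᵘ ((+ suc p) / 1) U.* ℚ.toℚᵘ ((+ n) / suc p)
      ≈⟨ UP.*-cong (toℚᵘ-/ (suc p) 0) (toℚᵘ-/ n p) ⟩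
    U.mkℚᵘ (+ suc p) 0 U.* U.mkℚᵘ (+ n) p
      ≈⟨ U.*≡* cross ⟩
    U.mkℚᵘ (+ n) 0
      ≈⟨ UP.≃-sym (toℚᵘ-/ n 0) ⟩
    ℚ.toℚᵘ ((+ n) / 1) ∎
    where open UP.≃-Reasoning

/1-mono-≤ : ∀ {m n} → m ℕ.≤ n → (+ m) / 1 ≤ (+ n) / 1
/1-mono-≤ {m} {n} m≤n = ℚP.toℚᵘ-cancel-≤
  (UP.≤-respˡ-≃ (UP.≃-sym (toℚᵘ-/ m 0)) (UP.≤-respʳ-≃ (UP.≃-sym (toℚᵘ-/ n 0))
    (U.*≤* (subst₂ ℤ._≤_ (sym (ℤP.*-identityʳ (+ m))) (sym (ℤP.*-identityʳ (+ n))) (ℤ.+≤+ m≤n)))))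

1≤inv : (β : ℚ) (β>0 : 0ℚ < β) → β ≤ 1ℚ → 1ℚ ≤ inv β β>0
1≤inv β β>0 β≤1 = begin
  1ℚ       ≡⟨ sym (ℚP.*-inverseˡ β {{ℚ.>-nonZero β>0}}) ⟩
  β⁻¹ * β  ≤⟨ ℚP.*-monoˡ-≤-nonNeg β⁻¹ {{β⁻¹≥0}} β≤1 ⟩
  β⁻¹ * 1ℚ ≡⟨ ℚP.*-identityʳ β⁻¹ ⟩
  β⁻¹ ∎
  where
  open ℚP.≤-Reasoning
  β⁻¹ = inv β β>0
  β⁻¹≥0 : ℚ.NonNegative β⁻¹
  β⁻¹≥0 = ℚP.pos⇒nonNeg β⁻¹ {{ℚP.1/pos⇒pos β {{ℚ.positive β>0}}}}

module _ (P : ℕ) (pr : Prime P) where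
  open ZMod P pr

  ⋂-elim : ∀ {l} (A : Fin l → Subset P) {x} → x ∈ ⋂ᶠ A → ∀ i → x ∈ A i
  ⋂-elim {suc l} A x∈⋂ F.zero    = p∩q⊆p (A F.zero) _ x∈⋂
  ⋂-elim {suc l} A x∈⋂ (F.suc i) = ⋂-elim (λ i → A (F.suc i)) (p∩q⊆q (A F.zero) _ x∈⋂) i

  ⋂-intro : ∀ {l} (A : Fin l → Subset P) {x} → (∀ i → x ∈ A i) → x ∈ ⋂ᶠ A
  ⋂-intro {zero}  A x∈A = ∈⊤
  ⋂-intro {suc l} A x∈A = x∈p∩q⁺ (x∈A F.zero , ⋂-intro (λ i → A (F.suc i)) (λ i → x∈A (F.suc i)))

  ⋂-subfamily : ∀ {l r} (A : Fin l → Subset P) (σ : Fin r → Fin l) → ⋂ᶠ A ⊆ ⋂ᶠ (λ k → A (σ k))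
  ⋂-subfamily A σ x∈⋂ = ⋂-intro (λ k → A (σ k)) (λ k → ⋂-elim A x∈⋂ (σ k))

  toℕ-mod : ∀ n → toℕ (n mod P) ≡ n % P
  toℕ-mod n = FP.toℕ-fromℕ< _

  toℕ-+ₘ : ∀ a b → toℕ (a +ₘ b) ≡ (toℕ a ℕ.+ toℕ b) % P
  toℕ-+ₘ a b = toℕ-mod (toℕ a ℕ.+ toℕ b)

  +ₘ-comm : ∀ a b → a +ₘ b ≡ b +ₘ a
  +ₘ-comm a b = cong (_mod P) (ℕP.+-comm (toℕ a) (toℕ b))

  +ₘ-cancel : ∀ z h → (z +ₘ h) -ₘ h ≡ z
  +ₘ-cancel z h = FP.toℕ-injective (begin
    toℕ ((z +ₘ h) -ₘ h)                   ≡⟨ toℕ-+ₘ (z +ₘ h) (-ₘ h) ⟩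
    (toℕ (z +ₘ h) ℕ.+ toℕ (-ₘ h)) % P     ≡⟨ cong₂ (λ a b → (a ℕ.+ b) % P) (toℕ-+ₘ z h) (toℕ-mod (P ∸ H)) ⟩
    ((Z ℕ.+ H) % P ℕ.+ (P ∸ H) % P) % P   ≡⟨ sym (%-distribˡ-+ (Z ℕ.+ H) (P ∸ H) P) ⟩
    (Z ℕ.+ H ℕ.+ (P ∸ H)) % P             ≡⟨ cong (_% P) (ℕP.+-assoc Z H (P ∸ H)) ⟩
    (Z ℕ.+ (H ℕ.+ (P ∸ H))) % P           ≡⟨ cong (λ t → (Z ℕ.+ t) % P) (ℕP.m+[n∸m]≡n (ℕP.<⇒≤ (FP.toℕ<n h))) ⟩
    (Z ℕ.+ P) % P                         ≡⟨ [m+n]%n≡m%n Z P ⟩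
    Z % P                                 ≡⟨ m<n⇒m%n≡m (FP.toℕ<n z) ⟩
    Z ∎)
    where
    open ≡-Reasoning
    Z = toℕ z
    H = toℕ h

  -ₘ-involutive : ∀ b → -ₘ (-ₘ b) ≡ b
  -ₘ-involutive b = FP.toℕ-injective (begin
    toℕ (-ₘ (-ₘ b))             ≡⟨ toℕ-mod _ ⟩
    (P ∸ toℕ (-ₘ b)) % P        ≡⟨ cong (λ t → (P ∸ t) % P) (toℕ-mod _) ⟩
    (P ∸ (P ∸ toℕ b) % P) % P   ≡⟨ residue (toℕ b) (FP.toℕ<n b) ⟩
    toℕ b ∎)
    where
    open ≡-Reasoning
    residue : ∀ n → n ℕ.< P → (P ∸ (P ∸ n) % P) % P ≡ n
    residue zero    _   = trans (cong (λ t → (P ∸ t) % P) (n%n≡0 P)) (n%n≡0 P)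
    residue (suc n) n<P = begin
      (P ∸ (P ∸ suc n) % P) % P ≡⟨ cong (λ t → (P ∸ t) % P) (m<n⇒m%n≡m (ℕP.∸-monoʳ-< {P} {suc n} {0} (s≤s z≤n) (ℕP.<⇒≤ n<P))) ⟩
      (P ∸ (P ∸ suc n)) % P     ≡⟨ cong (_% P) (ℕP.m∸[m∸n]≡n (ℕP.<⇒≤ n<P)) ⟩
      suc n % P                 ≡⟨ m<n⇒m%n≡m n<P ⟩
      suc n ∎

  -ₘ-cancel : ∀ z h → (z -ₘ h) +ₘ h ≡ z
  -ₘ-cancel z h = trans (cong ((z -ₘ h) +ₘ_) (sym (-ₘ-involutive h))) (+ₘ-cancel z (-ₘ h))

  -ₘ-sub : ∀ a b → (-ₘ a) -ₘ (-ₘ b) ≡ b -ₘ a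
  -ₘ-sub a b = trans (cong ((-ₘ a) +ₘ_) (-ₘ-involutive b)) (+ₘ-comm (-ₘ a) b)

  translation : ZP → Permutation′ P
  translation h = permutation (_-ₘ h) (_+ₘ h) (λ z → +ₘ-cancel z h) (λ z → -ₘ-cancel z h)

  card-+ₛ : ∀ C h → card (C +ₛ h) ≡ card C
  card-+ₛ C h = card-preimage C (translation h)

  module Representatives (S' : Subset P) {l r : ℕ} (y : Fin l → ZP) (components : NumComponents S' y r) where
    comp : Fin l → Fin r
    comp = proj₁ components

    rep : Fin r → Fin l
    rep k = proj₁ (proj₁ (proj₂ components) k)

    comp-rep : ∀ k → comp (rep k) ≡ k
    comp-rep k = proj₂ (proj₁ (proj₂ components) k)

    rep-separated : ∀ a b → a ≢ b → (y (rep a) -ₘ y (rep b)) ∉ S'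
    rep-separated a b a≢b edge = a≢b (begin
      a               ≡⟨ sym (comp-rep a) ⟩
      comp (rep a)    ≡⟨ proj₂ (proj₂ (proj₂ components) (rep a) (rep b)) (inj₂ edge ◅ ε) ⟩
      comp (rep b)    ≡⟨ comp-rep b ⟩
      b ∎)
      where open ≡-Reasoning

    shift : Fin r → ZP
    shift k = -ₘ y (rep k)

    shift-separated : ∀ a b → a ≢ b → (shift a -ₘ shift b) ∉ S'
    shift-separated a b a≢b = subst (_∉ S') (sym (-ₘ-sub (y (rep a)) (y (rep b))))
                                    (rep-separated b a (λ b≡a → a≢b (sym b≡a)))

  card≡P*d : ∀ A → (+ card A) / 1 ≡ ((+ P) / 1) * d A
  card≡P*d A = n≡P*n/P P (card A)

  one-component-bound : (C : Subset P) (β : ℚ) (β>0 : 0ℚ < β) → β ≤ 1ℚ →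
    ∀ {l} (y : Fin (suc l) → ZP) →
    (+ card (⋂ᶠ (λ i → C -ₛ y i))) / 1 ≤ ((1ℚ * ((+ P) / 1)) * (d C ^ℚ 1)) * inv β β>0 ^ℚ 1
  one-component-bound C β β>0 β≤1 y = begin
    (+ card X) / 1            ≤⟨ /1-mono-≤ (p⊆q⇒∣p∣≤∣q∣ (λ x∈X → ⋂-elim (λ i → C -ₛ y i) x∈X F.zero)) ⟩
    (+ card (C -ₛ y F.zero)) / 1 ≡⟨ cong (λ n → (+ n) / 1) (card-+ₛ C (-ₘ y F.zero)) ⟩
    (+ card C) / 1            ≡⟨ card≡P*d C ⟩
    P' * d C                  ≡⟨ sym (ℚP.*-identityʳ (P' * d C)) ⟩
    (P' * d C) * 1ℚ           ≤⟨ ℚP.*-monoˡ-≤-nonNeg (P' * d C) {{P*d≥0}} (1≤inv β β>0 β≤1) ⟩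
    (P' * d C) * β⁻¹          ≡⟨ solve 3 (λ p δ b → (p ⊕ δ) ⊕ b ⊜ ((id ⊕ p) ⊕ (δ ⊕ id)) ⊕ (b ⊕ id)) refl P' (d C) β⁻¹ ⟩
    ((1ℚ * P') * (d C * 1ℚ)) * (β⁻¹ * 1ℚ) ∎
    where
    open ℚP.≤-Reasoning
    X = ⋂ᶠ (λ i → C -ₛ y i)
    P' = (+ P) / 1
    β⁻¹ = inv β β>0
    P*d≥0 : ℚ.NonNegative (P' * d C)
    P*d≥0 = subst ℚ.NonNegative (card≡P*d C) (ℚP.normalize-nonNeg (card C) 1)

  components-bound : (C S' : Subset P) (β : ℚ) (β>0 : 0ℚ < β) (c : ℕ → ℚ) (r : ℕ) →
    ((h : Fin r → ZP) → ((i j : Fin r) → i ≢ j → (h i -ₘ h j) ∉ S') →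
      d (⋂ᶠ (λ i → C +ₛ h i)) ≤ (c r * (inv β β>0 ^ℚ r)) * (d C ^ℚ r)) →
    ∀ {l} (y : Fin l → ZP) → NumComponents S' y r →
    (+ card (⋂ᶠ (λ i → C -ₛ y i))) / 1 ≤ ((c r * ((+ P) / 1)) * (d C ^ℚ r)) * inv β β>0 ^ℚ r
  components-bound C S' β β>0 c r density-bound y components = begin
    (+ card X) / 1    ≤⟨ /1-mono-≤ (p⊆q⇒∣p∣≤∣q∣ (⋂-subfamily (λ i → C -ₛ y i) rep)) ⟩
    (+ card Y) / 1    ≡⟨ card≡P*d Y ⟩
    P' * d Y          ≤⟨ ℚP.*-monoˡ-≤-nonNeg P' {{ℚP.normalize-nonNeg P 1}} (density-bound shift shift-separated) ⟩
    P' * ((c r * I) * D) ≡⟨ solve 4 (λ p γ i δ → p ⊕ ((γ ⊕ i) ⊕ δ) ⊜ ((γ ⊕ p) ⊕ δ) ⊕ i) refl P' (c r) I D ⟩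
    ((c r * P') * D) * I ∎
    where
    open ℚP.≤-Reasoning
    open Representatives S' y components
    X = ⋂ᶠ (λ i → C -ₛ y i)
    Y = ⋂ᶠ (λ k → C +ₛ shift k)
    P' = (+ P) / 1
    I = inv β β>0 ^ℚ r
    D = d C ^ℚ r

lemma4 : (P : ℕ) (pr : Prime P) → let open ZMod P pr in
    (C : Subset P) → (∃ λ x → x ∈ C) →
    (S' : Subset P) → Symmetric S' → 0ₘ ∈ S' →
    (β : ℚ) (β>0 : 0ℚ < β) → β ≤ 1ℚ →
    (c : ℕ → ℚ) → ((l : ℕ) → 0ℚ < c l) →
    ((l : ℕ) → l ≥ 2 → (h : Fin l → ZP) →
      ((i j : Fin l) → i ≢ j → (h i -ₘ h j) ∉ S') →
      d (⋂ᶠ (λ i → C +ₛ h i)) ≤ (c l * (inv β β>0 ^ℚ l)) * (d C ^ℚ l)) →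
    (B : Subset P) (l : ℕ) → l ≥ 1 →
    (y : Fin l → ZP) → ((i : Fin l) → y i ∈ B) →
    (r : ℕ) → NumComponents S' y r →
    (+ card (⋂ᶠ (λ i → C -ₛ y i))) / 1 ≤ ((cExt c r * (+ P / 1)) * (d C ^ℚ r)) * inv β β>0 ^ℚ r
-- the index 0 of the nonempty family ỹ lies in some component, so r ≠ 0
lemma4 _ _ _ _ _ _ _ _ _ _ _ _ _ _ (suc _) _ _ _ zero (comp , _) with comp F.zero
... | ()
lemma4 P pr C _ _ _ _ β β>0 β≤1 _ _ _ _ (suc _) _ y _ (suc zero) _ =
  one-component-bound P pr C β β>0 β≤1 y
lemma4 P pr C _ S' _ _ β β>0 _ c _ hyp _ (suc _) _ y _ r@(suc (suc _)) components =
  components-bound P pr C S' β β>0 c r (hyp r (s≤s (s≤s z≤n))) y components
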